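{- Let $c\ge 10$ and let $G_{r,c}$ be a balanced $c$-partite tournament with partite sets $V_1,\dots,V_c$ such that $\delta(G_{r,c})\ge r(c-1)\frac{c+6}{4(c+1)}$. Then for every $x\in V_c$, writing $q=\lfloor\frac{c-2}{4}\rfloor$, $$\sum_{k=0}^{q}\binom{c-1}{k}\left(\frac{d^+(x)}{d^-(x)}\right)^{k}<\begin{cases}\binom{c-1}{q}\left(\frac{3c-2}{2c-4}\right)\left(\frac{d^+(x)}{d^-(x)}\right)^{q}, & \text{if } d^+(x)\ge d^-(x),\\[2mm] \binom{c-1}{q}\left(\frac{3c-2}{2c-4}\right)\left(\frac{d^-(x)}{d^+(x)}\right)^{q}, & \text{if } d^+(x)<d^-(x).\end{cases}$$
   Context: A $c$-partite tournament is an orientation of a complete $c$-partite graph; it is balanced, denoted $G_{r,c}$, if each partite set has exactly $r$ vertices. $d^+(x),d^-(x)$ denote out- and in-degree of $x$, and $\delta(G_{r,c})=\min\{d^j(x): x\in V(G_{r,c}),\ j\in\{+,-\}\}$. -}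

module Defs where

open import Data.Nat as ℕ using (ℕ; zero; suc)
open import Data.Bool using (Bool; true; false; if_then_else_; _xor_)
open import Data.Fin using (Fin)
open import Data.List using (List; map; allFin)
open import Data.Nat.ListAction using (sum)
open import Data.Product using (_×_; _,_; proj₁)
open import Data.Integer using (+_)
open import Data.Rational as ℚ using (ℚ; 0ℚ; 1ℚ)
open import Relation.Binary.PropositionalEquality using (_≡_; _≢_)

-- Vertices of a balanced c-partite graph with partite sets of size r:
-- vertex (i , j) is the j-th vertex of the partite set V_i.
Vtx : ℕ → ℕ → Set
Vtx c r = Fin c × Fin r

-- A balanced c-partite tournament G_{r,c}: an orientation of the complete
-- c-partite graph K_{r,...,r}.  arc u v = true means u → v.
record MultiTournament (r c : ℕ) : Set where
  field
    arc : Vtx c r → Vtx c r → Bool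
    noArcInPart : ∀ (u v : Vtx c r) → proj₁ u ≡ proj₁ v → arc u v ≡ false
    oneArcAcross : ∀ (u v : Vtx c r) → proj₁ u ≢ proj₁ v → arc u v xor arc v u ≡ true
open MultiTournament public

b2n : Bool → ℕ
b2n true = 1
b2n false = 0

countV : ∀ {c r} → (Vtx c r → Bool) → ℕ
countV {c} {r} P = sum (map (λ i → sum (map (λ j → b2n (P (i , j))) (allFin r))) (allFin c))

outdeg : ∀ {r c} → MultiTournament r c → Vtx c r → ℕ
outdeg T x = countV (λ y → arc T x y)

indeg : ∀ {r c} → MultiTournament r c → Vtx c r → ℕ
indeg T x = countV (λ y → arc T y x)

ℕtoℚ : ℕ → ℚ
ℕtoℚ n = + n ℚ./ 1

-- the rational a / b (b > 0 in all uses; 0 returned when b = 0 as a convention)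
ratio : ℕ → ℕ → ℚ
ratio a zero = 0ℚ
ratio a (suc b) = + a ℚ./ suc b

_^ℚ_ : ℚ → ℕ → ℚ
p ^ℚ zero = 1ℚ
p ^ℚ suc k = p ℚ.* (p ^ℚ k)

sumTo : ℕ → (ℕ → ℚ) → ℚ
sumTo zero f = f 0
sumTo (suc n) f = sumTo n f ℚ.+ f (suc n)

{-# OPTIONS --safe #-}
-- Put t = d⁺(x)/d⁻(x) and q = ⌊(c − 2)/4⌋. If t ≥ 1 then t^k ≤ t^q for k ≤ q, and if t < 1 then
-- t^k ≤ 1 ≤ (1/t)^q; either way the left side is at most Σ_{k≤q} C(c−1,k) times the power on the
-- right. For 4(j + 1) ≤ c − 2 consecutive binomial coefficients satisfy
-- C(c−1,j+1)/C(c−1,j) ≥ (3c − 2)/(c + 2), so the partial sum is dominated by a geometric series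
-- with that ratio, whose sum is C(c−1,q)(3c − 2)/(2c − 4). Writing e = c − 2, these ratios are
-- (3e + 4)/(e + 4) and (3e + 4)/(2e). The degree hypothesis only serves to make d⁺(x) and d⁻(x)
-- positive, so that the ratios are not the junk value ratio a 0 = 0.
module Submission where

open import Defs
open import Data.Nat as ℕ using (ℕ; _∸_; _≤_)
open import Data.Nat.Combinatorics using (_C_)
open import Data.Nat.DivMod using (_/_)
open import Data.Fin using (toℕ)
open import Data.Product using (proj₁; _×_)
open import Data.Rational as ℚ using (ℚ)
open import Relation.Binary.PropositionalEquality using (_≡_)

import Algebra.Properties.CommutativeSemigroup as CommSemigroupProperties
open import Data.Integer as ℤ using (+_)
import Data.Integer.Properties as ℤₚ
open import Data.Nat using (zero; suc; _+_; _*_; _<_; _!; z≤n; s≤s; _≤′_; ≤′-refl; ≤′-step)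
open import Data.Nat.Combinatorics using (nCk≡n!/k![n-k]!; k![n∸k]!∣n!; [n-k]*d[k+1]≡[k+1]*d[k])
open import Data.Nat.DivMod using (m/n*n≡m; m/n*n≤m)
import Data.Nat.Properties as ℕₚ
open import Data.Nat.Properties using (_!*_!≢0)
open import Data.Nat.Tactic.RingSolver using (solve-∀)
open import Data.Empty using (⊥-elim)
open import Data.Product using (_,_)
open import Data.Rational using (0ℚ; 1ℚ; toℚᵘ; NonNegative)
import Data.Rational.Properties as ℚₚ
open import Data.Rational.Unnormalised as ℚᵘ using (mkℚᵘ)
import Data.Rational.Unnormalised.Properties as ℚᵘₚ
open import Relation.Binary.PropositionalEquality using (refl; sym; trans; cong; cong₂; subst; subst₂; module ≡-Reasoning)

open CommSemigroupProperties ℕₚ.*-commutativeSemigroup using (x∙yz≈y∙xz; xy∙z≈xz∙y)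

sumToℕ : ℕ → (ℕ → ℕ) → ℕ
sumToℕ zero    f = f 0
sumToℕ (suc n) f = sumToℕ n f + f (suc n)

nCk*k!*[n∸k]!≡n! : ∀ {n k} → k ≤ n → (n C k) * (k ! * (n ∸ k) !) ≡ n !
nCk*k!*[n∸k]!≡n! {n} {k} k≤n =
  trans (cong (_* (k ! * (n ∸ k) !)) (nCk≡n!/k![n-k]! k≤n))
        (m/n*n≡m {{k !* (n ∸ k) !≢0}} (k![n∸k]!∣n! k≤n))

nCk*[n∸k]≡nC[1+k]*[1+k] : ∀ {n k} → k < n → (n C k) * (n ∸ k) ≡ (n C suc k) * suc k
nCk*[n∸k]≡nC[1+k]*[1+k] {n} {k} k<n = ℕₚ.*-cancelʳ-≡ _ _ d₁ {{suc k !* (n ∸ suc k) !≢0}} (begin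
  (n C k) * (n ∸ k) * d₁         ≡⟨ ℕₚ.*-assoc (n C k) (n ∸ k) d₁ ⟩
  (n C k) * ((n ∸ k) * d₁)       ≡⟨ cong ((n C k) *_) ([n-k]*d[k+1]≡[k+1]*d[k] k<n) ⟩
  (n C k) * (suc k * d₀)         ≡⟨ x∙yz≈y∙xz (n C k) (suc k) d₀ ⟩
  suc k * ((n C k) * d₀)         ≡⟨ cong (suc k *_) (nCk*k!*[n∸k]!≡n! (ℕₚ.<⇒≤ k<n)) ⟩
  suc k * n !                    ≡⟨ cong (suc k *_) (nCk*k!*[n∸k]!≡n! k<n) ⟨
  suc k * ((n C suc k) * d₁)     ≡⟨ x∙yz≈y∙xz (suc k) (n C suc k) d₁ ⟩
  (n C suc k) * (suc k * d₁)     ≡⟨ ℕₚ.*-assoc (n C suc k) (suc k) d₁ ⟨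
  (n C suc k) * suc k * d₁       ∎)
  where
  open ≡-Reasoning
  d₀ = k ! * (n ∸ k) !
  d₁ = suc k ! * (n ∸ suc k) !

[3e+4]*[1+j]≤[1+e∸j]*[e+4] : ∀ {e} j → 4 * suc j ≤ e → (3 * e + 4) * suc j ≤ (suc e ∸ j) * (e + 4)
[3e+4]*[1+j]≤[1+e∸j]*[e+4] {e} j 4[1+j]≤e =
  subst P (ℕₚ.m+[n∸m]≡n 4[1+j]≤e) (shifted (e ∸ 4 * suc j))
  where
  P : ℕ → Set
  P e = (3 * e + 4) * suc j ≤ (suc e ∸ j) * (e + 4)
  -- Writing e = 4(j + 1) + f, the right side exceeds the left by a polynomial with
  -- nonnegative coefficients.
  expand : ∀ j f → let e = 4 * suc j + f in
    (3 * e + 4) * suc j + (16 * j + 24 + 4 * f * j + 10 * f + f * f) ≡ (3 * j + 5 + f) * (e + 4)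
  expand = solve-∀
  split : ∀ j f → suc (4 * suc j + f) ≡ j + (3 * j + 5 + f)
  split = solve-∀
  shifted : ∀ f → P (4 * suc j + f)
  shifted f = begin
    (3 * e′ + 4) * suc j                          ≤⟨ ℕₚ.m≤m+n _ _ ⟩
    (3 * e′ + 4) * suc j + (16 * j + 24 + 4 * f * j + 10 * f + f * f)
                                                  ≡⟨ expand j f ⟩
    (3 * j + 5 + f) * (e′ + 4)                    ≡⟨ cong (_* (e′ + 4)) [1+e′]∸j≡3j+5+f ⟨
    (suc e′ ∸ j) * (e′ + 4)                       ∎
    where
    open ℕₚ.≤-Reasoning
    e′ = 4 * suc j + f
    [1+e′]∸j≡3j+5+f : suc e′ ∸ j ≡ 3 * j + 5 + f
    [1+e′]∸j≡3j+5+f = trans (cong (_∸ j) (split j f)) (ℕₚ.m+n∸m≡n j _)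

[1+e]Cj*[3e+4]≤[1+e]C[1+j]*[e+4] : ∀ {e} j → 4 * suc j ≤ e →
  (suc e C j) * (3 * e + 4) ≤ (suc e C suc j) * (e + 4)
[1+e]Cj*[3e+4]≤[1+e]C[1+j]*[e+4] {e} j 4[1+j]≤e = ℕₚ.*-cancelʳ-≤ _ _ (suc j) (begin
  A * (3 * e + 4) * suc j           ≡⟨ ℕₚ.*-assoc A (3 * e + 4) (suc j) ⟩
  A * ((3 * e + 4) * suc j)         ≤⟨ ℕₚ.*-monoʳ-≤ A ([3e+4]*[1+j]≤[1+e∸j]*[e+4] j 4[1+j]≤e) ⟩
  A * ((suc e ∸ j) * (e + 4))       ≡⟨ ℕₚ.*-assoc A (suc e ∸ j) (e + 4) ⟨
  A * (suc e ∸ j) * (e + 4)         ≡⟨ cong (_* (e + 4)) (nCk*[n∸k]≡nC[1+k]*[1+k] j<1+e) ⟩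
  B * suc j * (e + 4)               ≡⟨ xy∙z≈xz∙y B (suc j) (e + 4) ⟩
  B * (e + 4) * suc j               ∎)
  where
  open ℕₚ.≤-Reasoning
  A = suc e C j
  B = suc e C suc j
  j<1+e : j < suc e
  j<1+e = ℕₚ.m≤n⇒m≤1+n (ℕₚ.≤-trans (ℕₚ.m≤n*m (suc j) 4) 4[1+j]≤e)

sum[1+e]C≤j*2e<[1+e]Cj*[3e+4] : ∀ e j → 4 * j ≤ e →
  sumToℕ j (suc e C_) * (2 * e) < (suc e C j) * (3 * e + 4)
sum[1+e]C≤j*2e<[1+e]Cj*[3e+4] e zero _ = ℕₚ.*-monoʳ-< 1 2e<3e+4
  where
  eq : ∀ e → suc (2 * e + (e + 3)) ≡ 3 * e + 4
  eq = solve-∀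
  2e<3e+4 : 2 * e < 3 * e + 4
  2e<3e+4 = subst (2 * e <_) (eq e) (s≤s (ℕₚ.m≤m+n (2 * e) (e + 3)))
sum[1+e]C≤j*2e<[1+e]Cj*[3e+4] e (suc j) 4[1+j]≤e = begin-strict
  (S + B) * (2 * e)                   ≡⟨ ℕₚ.*-distribʳ-+ (2 * e) S B ⟩
  S * (2 * e) + B * (2 * e)           <⟨ ℕₚ.+-monoˡ-< _ (sum[1+e]C≤j*2e<[1+e]Cj*[3e+4] e j 4j≤e) ⟩
  A * (3 * e + 4) + B * (2 * e)       ≤⟨ ℕₚ.+-monoˡ-≤ _ ([1+e]Cj*[3e+4]≤[1+e]C[1+j]*[e+4] j 4[1+j]≤e) ⟩
  B * (e + 4) + B * (2 * e)           ≡⟨ eq B e ⟩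
  B * (3 * e + 4)                     ∎
  where
  open ℕₚ.≤-Reasoning
  S = sumToℕ j (suc e C_)
  A = suc e C j
  B = suc e C suc j
  4j≤e : 4 * j ≤ e
  4j≤e = ℕₚ.≤-trans (ℕₚ.*-monoʳ-≤ 4 (ℕₚ.n≤1+n j)) 4[1+j]≤e
  eq : ∀ b e → b * (e + 4) + b * (2 * e) ≡ b * (3 * e + 4)
  eq = solve-∀

toℚᵘ-ratio : ∀ a d → toℚᵘ (ratio a (suc d)) ℚᵘ.≃ mkℚᵘ (+ a) d
toℚᵘ-ratio a d = ℚₚ.toℚᵘ-fromℚᵘ (mkℚᵘ (+ a) d)

ratio-≤ : ∀ {a b d e} → a * suc e ≤ b * suc d → ratio a (suc d) ℚ.≤ ratio b (suc e)
ratio-≤ {a} {b} {d} {e} h = ℚₚ.toℚᵘ-cancel-≤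
  (ℚᵘₚ.≤-respˡ-≃ (ℚᵘₚ.≃-sym (toℚᵘ-ratio a d)) (ℚᵘₚ.≤-respʳ-≃ (ℚᵘₚ.≃-sym (toℚᵘ-ratio b e))
    (ℚᵘ.*≤* (subst₂ ℤ._≤_ (ℤₚ.pos-* a (suc e)) (ℤₚ.pos-* b (suc d)) (ℤ.+≤+ h)))))

ratio-< : ∀ {a b d e} → a * suc e < b * suc d → ratio a (suc d) ℚ.< ratio b (suc e)
ratio-< {a} {b} {d} {e} h = ℚₚ.toℚᵘ-cancel-<
  (ℚᵘₚ.<-respˡ-≃ (ℚᵘₚ.≃-sym (toℚᵘ-ratio a d)) (ℚᵘₚ.<-respʳ-≃ (ℚᵘₚ.≃-sym (toℚᵘ-ratio b e))
    (ℚᵘ.*<* (subst₂ ℤ._<_ (ℤₚ.pos-* a (suc e)) (ℤₚ.pos-* b (suc d)) (ℤ.+<+ h)))))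

ratio-* : ∀ a b d e → ratio a (suc d) ℚ.* ratio b (suc e) ≡ ratio (a * b) (suc d * suc e)
ratio-* a b d e = ℚₚ.toℚᵘ-injective (begin
  toℚᵘ (ratio a (suc d) ℚ.* ratio b (suc e))            ≈⟨ ℚₚ.toℚᵘ-homo-* (ratio a (suc d)) (ratio b (suc e)) ⟩
  toℚᵘ (ratio a (suc d)) ℚᵘ.* toℚᵘ (ratio b (suc e))    ≈⟨ ℚᵘₚ.*-cong (toℚᵘ-ratio a d) (toℚᵘ-ratio b e) ⟩
  mkℚᵘ (+ a) d ℚᵘ.* mkℚᵘ (+ b) e                        ≡⟨ cong (λ n → mkℚᵘ n (e + d * suc e)) (ℤₚ.pos-* a b) ⟨
  mkℚᵘ (+ (a * b)) (e + d * suc e)                       ≈⟨ toℚᵘ-ratio (a * b) (e + d * suc e) ⟨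
  toℚᵘ (ratio (a * b) (suc d * suc e))                   ∎)
  where open ℚᵘₚ.≃-Reasoning

ℕtoℚ-+ : ∀ a b → ℕtoℚ (a + b) ≡ ℕtoℚ a ℚ.+ ℕtoℚ b
ℕtoℚ-+ a b = ℚₚ.toℚᵘ-injective (begin
  toℚᵘ (ℕtoℚ (a + b))                    ≈⟨ toℚᵘ-ratio (a + b) 0 ⟩
  mkℚᵘ (+ (a + b)) 0                     ≡⟨ cong (λ n → mkℚᵘ n 0) +[a+b]≡+a*1++b*1 ⟩
  mkℚᵘ (+ a) 0 ℚᵘ.+ mkℚᵘ (+ b) 0         ≈⟨ ℚᵘₚ.+-cong (toℚᵘ-ratio a 0) (toℚᵘ-ratio b 0) ⟨
  toℚᵘ (ℕtoℚ a) ℚᵘ.+ toℚᵘ (ℕtoℚ b)       ≈⟨ ℚₚ.toℚᵘ-homo-+ (ℕtoℚ a) (ℕtoℚ b) ⟨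
  toℚᵘ (ℕtoℚ a ℚ.+ ℕtoℚ b)               ∎)
  where
  open ℚᵘₚ.≃-Reasoning
  +[a+b]≡+a*1++b*1 : + (a + b) ≡ + a ℤ.* + 1 ℤ.+ + b ℤ.* + 1
  +[a+b]≡+a*1++b*1 = trans (ℤₚ.pos-+ a b) (sym (cong₂ ℤ._+_ (ℤₚ.*-identityʳ (+ a)) (ℤₚ.*-identityʳ (+ b))))

ratio-nonNeg : ∀ a b → NonNegative (ratio a b)
ratio-nonNeg a zero    = _
ratio-nonNeg a (suc b) = ℚₚ.normalize-nonNeg a (suc b)

0<ratio : ∀ {a b} → 0 < a → 0 < b → 0ℚ ℚ.< ratio a b
0<ratio {a} {suc d} 0<a _ = ratio-< {0} {a} {0} {d} (subst (0 <_) (sym (ℕₚ.*-identityʳ a)) 0<a)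

1≤ratio : ∀ {a b} → 0 < b → b ≤ a → 1ℚ ℚ.≤ ratio a b
1≤ratio {a} {suc b} _ b≤a = ratio-≤ {1} {a} {0} {b}
  (subst₂ _≤_ (sym (ℕₚ.*-identityˡ (suc b))) (sym (ℕₚ.*-identityʳ a)) b≤a)

ratio≤1 : ∀ {a b} → a ≤ b → ratio a b ℚ.≤ 1ℚ
ratio≤1 {b = zero}  _   = ℚₚ.nonNegative⁻¹ 1ℚ
ratio≤1 {a} {suc b} a≤b = ratio-≤ {a} {1} {b} {0}
  (subst₂ _≤_ (sym (ℕₚ.*-identityʳ a)) (sym (ℕₚ.*-identityˡ (suc b))) a≤b)

0<ℚ≤ℕtoℚ⇒0< : ∀ {p n} → 0ℚ ℚ.< p → p ℚ.≤ ℕtoℚ n → 0 < n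
0<ℚ≤ℕtoℚ⇒0< {n = zero}  0<p p≤0 = ⊥-elim (ℚₚ.<-irrefl refl (ℚₚ.<-≤-trans 0<p p≤0))
0<ℚ≤ℕtoℚ⇒0< {n = suc n} _   _   = s≤s z≤n

ℕtoℚ<ℕtoℚ*ratio : ∀ {a b m n} → 0 < n → a * n < b * m → ℕtoℚ a ℚ.< ℕtoℚ b ℚ.* ratio m n
ℕtoℚ<ℕtoℚ*ratio {a} {b} {m} {suc d} _ a*n<b*m = subst (ℕtoℚ a ℚ.<_) (sym (ratio-* b m 0 d))
  (ratio-< {a} {b * m} {0} {d + 0}
    (subst₂ _<_ (cong (a *_) (cong suc (sym (ℕₚ.+-identityʳ d)))) (sym (ℕₚ.*-identityʳ (b * m))) a*n<b*m))

module _ {t : ℚ} (1≤t : 1ℚ ℚ.≤ t) where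

  private
    nonNeg : ∀ {p} → 1ℚ ℚ.≤ p → NonNegative p
    nonNeg 1≤p = ℚ.nonNegative (ℚₚ.≤-trans (ℚₚ.nonNegative⁻¹ 1ℚ) 1≤p)

  1≤^ℚ : ∀ k → 1ℚ ℚ.≤ t ^ℚ k
  1≤^ℚ zero    = ℚₚ.≤-refl
  1≤^ℚ (suc k) = ℚₚ.≤-trans 1≤t (ℚₚ.≤-trans (ℚₚ.≤-reflexive (sym (ℚₚ.*-identityʳ t)))
    (ℚₚ.*-monoˡ-≤-nonNeg t {{nonNeg 1≤t}} (1≤^ℚ k)))

  ^ℚ-monoʳ-≤′ : ∀ {k m} → k ≤′ m → t ^ℚ k ℚ.≤ t ^ℚ m
  ^ℚ-monoʳ-≤′ ≤′-refl                  = ℚₚ.≤-refl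
  ^ℚ-monoʳ-≤′ {m = suc m} (≤′-step k≤m) = ℚₚ.≤-trans (^ℚ-monoʳ-≤′ k≤m)
    (ℚₚ.≤-trans (ℚₚ.≤-reflexive (sym (ℚₚ.*-identityˡ (t ^ℚ m))))
      (ℚₚ.*-monoʳ-≤-nonNeg (t ^ℚ m) {{nonNeg (1≤^ℚ m)}} 1≤t))

  ^ℚ-monoʳ-≤ : ∀ {k m} → k ≤ m → t ^ℚ k ℚ.≤ t ^ℚ m
  ^ℚ-monoʳ-≤ k≤m = ^ℚ-monoʳ-≤′ (ℕₚ.≤⇒≤′ k≤m)

^ℚ≤1 : ∀ {t} .{{_ : NonNegative t}} → t ℚ.≤ 1ℚ → ∀ k → t ^ℚ k ℚ.≤ 1ℚ
^ℚ≤1         t≤1 zero    = ℚₚ.≤-refl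
^ℚ≤1 {t = t} t≤1 (suc k) = ℚₚ.≤-trans (ℚₚ.*-monoˡ-≤-nonNeg t (^ℚ≤1 t≤1 k))
  (ℚₚ.≤-trans (ℚₚ.≤-reflexive (ℚₚ.*-identityʳ t)) t≤1)

sumTo-mono-≤ : ∀ n {f g : ℕ → ℚ} → (∀ k → k ≤ n → f k ℚ.≤ g k) → sumTo n f ℚ.≤ sumTo n g
sumTo-mono-≤ zero    f≤g = f≤g 0 z≤n
sumTo-mono-≤ (suc n) f≤g =
  ℚₚ.+-mono-≤ (sumTo-mono-≤ n (λ k k≤n → f≤g k (ℕₚ.m≤n⇒m≤1+n k≤n))) (f≤g (suc n) ℕₚ.≤-refl)

sumTo-*-distribʳ : ∀ n (f : ℕ → ℚ) m → sumTo n (λ k → f k ℚ.* m) ≡ sumTo n f ℚ.* m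
sumTo-*-distribʳ zero    f m = refl
sumTo-*-distribʳ (suc n) f m = trans (cong (ℚ._+ f (suc n) ℚ.* m) (sumTo-*-distribʳ n f m))
  (sym (ℚₚ.*-distribʳ-+ m (sumTo n f) (f (suc n))))

sumTo-ℕtoℚ : ∀ n (f : ℕ → ℕ) → sumTo n (λ k → ℕtoℚ (f k)) ≡ ℕtoℚ (sumToℕ n f)
sumTo-ℕtoℚ zero    f = refl
sumTo-ℕtoℚ (suc n) f = trans (cong (ℚ._+ ℕtoℚ (f (suc n))) (sumTo-ℕtoℚ n f))
  (sym (ℕtoℚ-+ (sumToℕ n f) (f (suc n))))

sumTo-weighted-^ℚ-< : ∀ q (w : ℕ → ℕ) {t m y : ℚ} → 0ℚ ℚ.< m → (∀ k → k ≤ q → t ^ℚ k ℚ.≤ m) →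
  ℕtoℚ (sumToℕ q w) ℚ.< y → sumTo q (λ k → ℕtoℚ (w k) ℚ.* (t ^ℚ k)) ℚ.< y ℚ.* m
sumTo-weighted-^ℚ-< q w {t} {m} {y} 0<m t^k≤m ∑w<y = ℚₚ.≤-<-trans
  (sumTo-mono-≤ q (λ k k≤q → ℚₚ.*-monoˡ-≤-nonNeg (ℕtoℚ (w k)) {{ratio-nonNeg (w k) 1}} (t^k≤m k k≤q)))
  (subst (ℚ._< y ℚ.* m) (sym (trans (sumTo-*-distribʳ q (λ k → ℕtoℚ (w k)) m) (cong (ℚ._* m) (sumTo-ℕtoℚ q w))))
    (ℚₚ.*-monoˡ-<-pos m {{ℚ.positive 0<m}} ∑w<y))

2*[2+e]∸4≡2*e : ∀ e → 2 * suc (suc e) ∸ 4 ≡ 2 * e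
2*[2+e]∸4≡2*e e = trans (cong (_∸ 4) (eq e)) (ℕₚ.m+n∸m≡n 4 (2 * e))
  where
  eq : ∀ e → 2 * suc (suc e) ≡ 4 + 2 * e
  eq = solve-∀

3*[2+e]∸2≡3*e+4 : ∀ e → 3 * suc (suc e) ∸ 2 ≡ 3 * e + 4
3*[2+e]∸2≡3*e+4 e = trans (cong (_∸ 2) (eq e)) (ℕₚ.m+n∸m≡n 2 (3 * e + 4))
  where
  eq : ∀ e → 3 * suc (suc e) ≡ 2 + (3 * e + 4)
  eq = solve-∀

∑[c-1]Ck<[c-1]Cq*[3c-2]/[2c-4] : ∀ c → 3 ≤ c →
  ℕtoℚ (sumToℕ ((c ∸ 2) / 4) ((c ∸ 1) C_))
    ℚ.< ℕtoℚ ((c ∸ 1) C ((c ∸ 2) / 4)) ℚ.* ratio (3 * c ∸ 2) (2 * c ∸ 4)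
∑[c-1]Ck<[c-1]Cq*[3c-2]/[2c-4] (suc (suc e)) (s≤s (s≤s 1≤e))
  rewrite 2*[2+e]∸4≡2*e e | 3*[2+e]∸2≡3*e+4 e =
  ℕtoℚ<ℕtoℚ*ratio {sumToℕ q (suc e C_)} {suc e C q} {3 * e + 4} {2 * e} (ℕₚ.*-monoʳ-< 2 1≤e)
    (sum[1+e]C≤j*2e<[1+e]Cj*[3e+4] e q (subst (_≤ e) (ℕₚ.*-comm q 4) (m/n*n≤m e 4)))
  where
  q : ℕ
  q = e / 4

lemma4 : (r c : ℕ) → 10 ≤ c → (G : MultiTournament r c)
    → (∀ (y : Vtx c r) → ratio (r ℕ.* (c ∸ 1) ℕ.* (c ℕ.+ 6)) (4 ℕ.* (c ℕ.+ 1)) ℚ.≤ ℕtoℚ (outdeg G y))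
    → (∀ (y : Vtx c r) → ratio (r ℕ.* (c ∸ 1) ℕ.* (c ℕ.+ 6)) (4 ℕ.* (c ℕ.+ 1)) ℚ.≤ ℕtoℚ (indeg G y))
    → (x : Vtx c r) → toℕ (proj₁ x) ≡ c ∸ 1
    → (outdeg G x ℕ.≥ indeg G x
        → sumTo ((c ∸ 2) / 4) (λ k → ℕtoℚ ((c ∸ 1) C k) ℚ.* (ratio (outdeg G x) (indeg G x) ^ℚ k))
          ℚ.< ℕtoℚ ((c ∸ 1) C ((c ∸ 2) / 4)) ℚ.* ratio (3 ℕ.* c ∸ 2) (2 ℕ.* c ∸ 4)
              ℚ.* (ratio (outdeg G x) (indeg G x) ^ℚ ((c ∸ 2) / 4)))
      × (outdeg G x ℕ.< indeg G x
        → sumTo ((c ∸ 2) / 4) (λ k → ℕtoℚ ((c ∸ 1) C k) ℚ.* (ratio (outdeg G x) (indeg G x) ^ℚ k))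
          ℚ.< ℕtoℚ ((c ∸ 1) C ((c ∸ 2) / 4)) ℚ.* ratio (3 ℕ.* c ∸ 2) (2 ℕ.* c ∸ 4)
              ℚ.* (ratio (indeg G x) (outdeg G x) ^ℚ ((c ∸ 2) / 4)))
lemma4 zero _ _ _ _ _ (_ , ()) _
lemma4 (suc r) c@(suc (suc _)) 10≤c@(s≤s (s≤s _)) G out-bound in-bound x _ =
  (λ d⁻≤d⁺ → sumTo-weighted-^ℚ-< q ((c ∸ 1) C_) (0<^ℚ (1≤t d⁻≤d⁺)) (λ _ → ^ℚ-monoʳ-≤ (1≤t d⁻≤d⁺)) ∑C<y)
  , (λ d⁺<d⁻ → sumTo-weighted-^ℚ-< q ((c ∸ 1) C_) (0<^ℚ (1≤t⁻¹ d⁺<d⁻))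
      (λ k _ → ℚₚ.≤-trans (^ℚ≤1 {{ratio-nonNeg d⁺ d⁻}} (ratio≤1 (ℕₚ.<⇒≤ d⁺<d⁻)) k) (1≤^ℚ (1≤t⁻¹ d⁺<d⁻) q))
      ∑C<y)
  where
  d⁺ d⁻ q : ℕ
  d⁺ = outdeg G x
  d⁻ = indeg G x
  q = (c ∸ 2) / 4
  ∑C<y : ℕtoℚ (sumToℕ q ((c ∸ 1) C_)) ℚ.< ℕtoℚ ((c ∸ 1) C q) ℚ.* ratio (3 * c ∸ 2) (2 * c ∸ 4)
  ∑C<y = ∑[c-1]Ck<[c-1]Cq*[3c-2]/[2c-4] c (ℕₚ.≤-trans (s≤s (s≤s (s≤s z≤n))) 10≤c)
  0<δ : 0ℚ ℚ.< ratio (suc r * (c ∸ 1) * (c + 6)) (4 * (c + 1))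
  0<δ = 0<ratio {suc r * (c ∸ 1) * (c + 6)} {4 * (c + 1)} (s≤s z≤n) (s≤s z≤n)
  0<d⁺ : 0 < d⁺
  0<d⁺ = 0<ℚ≤ℕtoℚ⇒0< 0<δ (out-bound x)
  0<d⁻ : 0 < d⁻
  0<d⁻ = 0<ℚ≤ℕtoℚ⇒0< 0<δ (in-bound x)
  1≤t : d⁻ ≤ d⁺ → 1ℚ ℚ.≤ ratio d⁺ d⁻
  1≤t = 1≤ratio 0<d⁻
  1≤t⁻¹ : d⁺ < d⁻ → 1ℚ ℚ.≤ ratio d⁻ d⁺
  1≤t⁻¹ d⁺<d⁻ = 1≤ratio 0<d⁺ (ℕₚ.<⇒≤ d⁺<d⁻)
  0<^ℚ : ∀ {s} → 1ℚ ℚ.≤ s → 0ℚ ℚ.< s ^ℚ q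
  0<^ℚ 1≤s = ℚₚ.<-≤-trans (ℚₚ.positive⁻¹ 1ℚ) (1≤^ℚ 1≤s q)
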